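{- Let $n\geq 1$ and $0\leq r\leq n-1$. The map $\phi_n$ restricts to a surjective map $K_R(r,n)\to K(r,n-1)$, and for every $w\in K(r,n-1)$ the fiber satisfies $|\phi_n^{ -1}(w)\cap K_R(r,n)|=n-r$.
   Context: Let $\mathfrak{S}_n$ be the group of permutations of $\{1,\dots,n\}$ in one-line notation ($\mathfrak{S}_0$ consists of the empty permutation). A permutation $w\in\mathfrak{S}_n$ contains the split pattern $3|12$ with respect to position $r$ if there are indices $i_1\leq r<i_2<i_3$ with $w(i_2)<w(i_3)<w(i_1)$; it contains $23|1$ with respect to position $r$ if there are indices $i_1<i_2\leq r<i_3$ with $w(i_3)<w(i_1)<w(i_2)$. $K(r,n)$ is the set of $w\in\mathfrak{S}_n$ avoiding both patterns with respect to position $r$. $K_R(r,n)$ is the set of $w\in K(r,n)$ with $n\in\{w(k): k>r\}$. The map $\phi_n:\mathfrak{S}_n\to\mathfrak{S}_{n-1}$ deletes the entry $n$ from the one-line notation (e.g. $\phi_6(432615)=43215$). -}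

module Defs where

open import Data.Nat using (ℕ; _<_; _≤_; _≟_; suc)
open import Data.Fin using (Fin; toℕ)
open import Data.List using (List; lookup; length; map; upTo; filter)
open import Data.List.Relation.Binary.Permutation.Propositional using (_↭_)
open import Data.Product using (_×_; ∃; ∃-syntax)
open import Relation.Nullary using (¬_; ¬?)
open import Relation.Binary.PropositionalEquality using (_≡_)

-- One-line notation: a permutation w ∈ 𝔖ₙ is the list [w(1), …, w(n)] of
-- natural numbers, which must be a rearrangement of [1, …, n].
-- (n = 0 gives the empty permutation.)
IsPerm : ℕ → List ℕ → Set
IsPerm n w = w ↭ map suc (upTo n)

-- List positions are 0-based: 0-based index i corresponds to position i+1.
-- Thus the 1-based condition  i ≤ r  becomes  i < r,  and  r < i  becomes  r ≤ i.

Contains3|12 : ℕ → List ℕ → Set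
Contains3|12 r w =
  ∃[ i₁ ] ∃[ i₂ ] ∃[ i₃ ]
    (toℕ {length w} i₁ < r × r ≤ toℕ i₂ × toℕ i₂ < toℕ i₃ ×
     lookup w i₂ < lookup w i₃ × lookup w i₃ < lookup w i₁)

Contains23|1 : ℕ → List ℕ → Set
Contains23|1 r w =
  ∃[ i₁ ] ∃[ i₂ ] ∃[ i₃ ]
    (toℕ {length w} i₁ < toℕ i₂ × toℕ i₂ < r × r ≤ toℕ i₃ ×
     lookup w i₃ < lookup w i₁ × lookup w i₁ < lookup w i₂)

InK : ℕ → ℕ → List ℕ → Set
InK r n w = IsPerm n w × ¬ Contains3|12 r w × ¬ Contains23|1 r w

InKR : ℕ → ℕ → List ℕ → Set
InKR r n w = InK r n w × (∃[ k ] (r ≤ toℕ {length w} k × lookup w k ≡ n))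

φ : ℕ → List ℕ → List ℕ
φ n w = filter (λ x → ¬? (x ≟ n)) w

{-# OPTIONS --safe #-}
-- Since n is the largest value, an occurrence of 3|12 or 23|1 can use n only as its largest
-- entry, and in both patterns that entry lies weakly left of r.  Hence inserting n at a position
-- right of r neither creates nor destroys occurrences: each w ∈ K(r,n-1) has exactly the n - r
-- lifts to K_R(r,n) obtained by inserting n at positions r+1, …, n, and every v ∈ K_R(r,n) is
-- such a lift of φₙ(v).
module Submission where

open import Defs
open import Data.Empty using (⊥-elim)
open import Data.Fin using (Fin; zero; suc; toℕ; fromℕ<)
open import Data.Fin.Properties using (toℕ-fromℕ<)
open import Data.List using (List; []; _∷_; [_]; _∷ʳ_; length; lookup; map; upTo; applyUpTo; removeAt)
open import Data.List.Properties
  using (∷-injectiveˡ; ∷-injectiveʳ; length-applyUpTo; length-map; length-upTo; map-++; upTo-∷ʳ;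
         filter-accept; filter-reject; filter-all)
open import Data.List.Membership.Propositional using (_∈_)
open import Data.List.Membership.Propositional.Properties
  using (∈-lookup; ∈-map⁻; ∈-upTo⁻; ∈-applyUpTo⁺; ∈-applyUpTo⁻)
open import Data.List.Relation.Unary.All as All using (All; []; _∷_)
open import Data.List.Relation.Unary.Unique.Propositional using (Unique)
open import Data.List.Relation.Unary.Unique.Propositional.Properties using (applyUpTo⁺₁)
open import Data.List.Relation.Binary.Permutation.Propositional
  using (_↭_; ↭-refl; ↭-sym; ↭-trans; prep; swap; module PermutationReasoning)
open import Data.List.Relation.Binary.Permutation.Propositional.Properties
  using (∷↭∷ʳ; drop-∷; ∈-resp-↭; ↭-length)
open import Data.Nat using (ℕ; zero; suc; _+_; _∸_; _≤_; _<_; z≤n; s≤s; s≤s⁻¹; z<s; s<s; s<s⁻¹)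
open import Data.Nat.Properties
open import Data.Product using (_×_; _,_; proj₁; ∃-syntax)
open import Data.Product.Function.NonDependent.Propositional using (_×-⇔_)
open import Function using (_∘_)
open import Function.Bundles using (_⇔_; mk⇔; module Equivalence)
import Function.Properties.Equivalence as ⇔
open import Relation.Nullary using (¬?)
open import Relation.Unary using (Decidable)
open import Relation.Binary.PropositionalEquality using (_≡_; _≢_; refl; sym; trans; cong; subst)

open Equivalence using (to; from)

private variable
  A : Set

-- Data.List.insertAt with a ℕ position; positions past the end append.
insertAtℕ : List A → ℕ → A → List A
insertAtℕ xs       zero    v = v ∷ xs
insertAtℕ []       (suc k) v = [ v ]
insertAtℕ (x ∷ xs) (suc k) v = x ∷ insertAtℕ xs k v

length-insertAtℕ : ∀ (xs : List A) k v → length (insertAtℕ xs k v) ≡ suc (length xs)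
length-insertAtℕ xs       zero    v = refl
length-insertAtℕ []       (suc k) v = refl
length-insertAtℕ (x ∷ xs) (suc k) v = cong suc (length-insertAtℕ xs k v)

insertAtℕ-↭ : ∀ (xs : List A) k v → insertAtℕ xs k v ↭ v ∷ xs
insertAtℕ-↭ xs       zero    v = ↭-refl
insertAtℕ-↭ []       (suc k) v = ↭-refl
insertAtℕ-↭ (x ∷ xs) (suc k) v = ↭-trans (prep x (insertAtℕ-↭ xs k v)) (swap x v ↭-refl)

insertAtℕ-removeAt : ∀ (xs : List A) i → xs ≡ insertAtℕ (removeAt xs i) (toℕ i) (lookup xs i)
insertAtℕ-removeAt (x ∷ xs) zero    = refl
insertAtℕ-removeAt (x ∷ xs) (suc i) = cong (x ∷_) (insertAtℕ-removeAt xs i)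

toℕ≤length-removeAt : ∀ (xs : List A) i → toℕ i ≤ length (removeAt xs i)
toℕ≤length-removeAt (x ∷ xs) zero    = z≤n
toℕ≤length-removeAt (x ∷ xs) (suc i) = s≤s (toℕ≤length-removeAt xs i)

insertAtℕ-injective : ∀ (xs : List A) {v} k l → All (_≢ v) xs → k ≤ length xs → l ≤ length xs →
                      insertAtℕ xs k v ≡ insertAtℕ xs l v → k ≡ l
insertAtℕ-injective xs       zero    zero    _           _        _        _  = refl
insertAtℕ-injective (x ∷ xs) zero    (suc l) (x≢v ∷ _)   _        _        eq =
  ⊥-elim (x≢v (sym (∷-injectiveˡ eq)))
insertAtℕ-injective (x ∷ xs) (suc k) zero    (x≢v ∷ _)   _        _        eq =
  ⊥-elim (x≢v (∷-injectiveˡ eq))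
insertAtℕ-injective (x ∷ xs) (suc k) (suc l) (_ ∷ xs≢v) (s≤s k≤) (s≤s l≤) eq =
  cong suc (insertAtℕ-injective xs k l xs≢v k≤ l≤ (∷-injectiveʳ eq))

InsertedBetween : List A → A → ℕ → ℕ → List A → Set
InsertedBetween xs v a b ys = ∃[ k ] (a ≤ k × k < b × ys ≡ insertAtℕ xs k v)

insertions : List A → A → ℕ → ℕ → List (List A)
insertions xs v a b = applyUpTo (λ j → insertAtℕ xs (a + j) v) (b ∸ a)

∈-insertions⇔ : ∀ (xs : List A) v {a b} → a ≤ b →
                ∀ ys → ys ∈ insertions xs v a b ⇔ InsertedBetween xs v a b ys
∈-insertions⇔ xs v {a} {b} a≤b ys = mk⇔ position member
  where
  position : ys ∈ insertions xs v a b → InsertedBetween xs v a b ys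
  position ys∈ with j , j<b∸a , refl ← ∈-applyUpTo⁻ _ ys∈ =
    a + j , m≤m+n a j , subst (a + j <_) (m+[n∸m]≡n a≤b) (+-monoʳ-< a j<b∸a) , refl

  member : InsertedBetween xs v a b ys → ys ∈ insertions xs v a b
  member (k , a≤k , k<b , refl) =
    subst (_∈ insertions xs v a b) (cong (λ i → insertAtℕ xs i v) (m+[n∸m]≡n a≤k))
          (∈-applyUpTo⁺ _ (∸-monoˡ-< k<b a≤k))

insertions-unique : ∀ (xs : List A) v {a b} → All (_≢ v) xs → a ≤ b → b ≤ suc (length xs) →
                    Unique (insertions xs v a b)
insertions-unique xs v {a} {b} xs≢v a≤b b≤1+∣xs∣ = applyUpTo⁺₁ _ (b ∸ a) distinct
  where
  a+j≤∣xs∣ : ∀ {j} → j < b ∸ a → a + j ≤ length xs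
  a+j≤∣xs∣ j<b∸a = s≤s⁻¹ (≤-trans (subst (a + _ <_) (m+[n∸m]≡n a≤b) (+-monoʳ-< a j<b∸a)) b≤1+∣xs∣)

  distinct : ∀ {i j} → i < j → j < b ∸ a → insertAtℕ xs (a + i) v ≢ insertAtℕ xs (a + j) v
  distinct i<j j<b∸a eq = <⇒≢ i<j (+-cancelˡ-≡ a _ _
    (insertAtℕ-injective xs _ _ xs≢v (a+j≤∣xs∣ (<-trans i<j j<b∸a)) (a+j≤∣xs∣ j<b∸a) eq))

punchIn : ∀ (xs : List A) k v → Fin (length xs) → Fin (length (insertAtℕ xs k v))
punchIn xs       zero    v i       = suc i
punchIn (x ∷ xs) (suc k) v zero    = zero
punchIn (x ∷ xs) (suc k) v (suc i) = suc (punchIn xs k v i)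

lookup-punchIn : ∀ (xs : List A) k v i → lookup (insertAtℕ xs k v) (punchIn xs k v i) ≡ lookup xs i
lookup-punchIn xs       zero    v i       = refl
lookup-punchIn (x ∷ xs) (suc k) v zero    = refl
lookup-punchIn (x ∷ xs) (suc k) v (suc i) = lookup-punchIn xs k v i

lookup-insertAtℕ : ∀ (xs : List A) k v j → toℕ j ≡ k → lookup (insertAtℕ xs k v) j ≡ v
lookup-insertAtℕ xs       zero    v zero    refl = refl
lookup-insertAtℕ (x ∷ xs) (suc k) v (suc j) j≡k  = lookup-insertAtℕ xs k v j (suc-injective j≡k)
lookup-insertAtℕ []       (suc k) v zero    ()

punchIn-surjective : ∀ (xs : List A) k v → k ≤ length xs →
                     ∀ j → toℕ j ≢ k → ∃[ i ] punchIn xs k v i ≡ j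
punchIn-surjective xs       zero    v _        zero    j≢k = ⊥-elim (j≢k refl)
punchIn-surjective xs       zero    v _        (suc i) _   = i , refl
punchIn-surjective (x ∷ xs) (suc k) v _        zero    _   = zero , refl
punchIn-surjective (x ∷ xs) (suc k) v (s≤s k≤) (suc j) j≢k
  with i , refl ← punchIn-surjective xs k v k≤ j (j≢k ∘ cong suc) = suc i , refl

toℕ≤toℕ-punchIn : ∀ (xs : List A) k v i → toℕ i ≤ toℕ (punchIn xs k v i)
toℕ≤toℕ-punchIn xs       zero    v i       = n≤1+n (toℕ i)
toℕ≤toℕ-punchIn (x ∷ xs) (suc k) v zero    = z≤n
toℕ≤toℕ-punchIn (x ∷ xs) (suc k) v (suc i) = s≤s (toℕ≤toℕ-punchIn xs k v i)

toℕ-punchIn-< : ∀ (xs : List A) k v i → toℕ i < k → toℕ (punchIn xs k v i) ≡ toℕ i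
toℕ-punchIn-< (x ∷ xs) (suc k) v zero    _       = refl
toℕ-punchIn-< (x ∷ xs) (suc k) v (suc i) (s<s i<k) = cong suc (toℕ-punchIn-< xs k v i i<k)

r≤toℕ-punchIn⇒r≤toℕ : ∀ (xs : List A) {r} k v i → r ≤ k → r ≤ toℕ (punchIn xs k v i) → r ≤ toℕ i
r≤toℕ-punchIn⇒r≤toℕ xs       {zero}  k       v i       _         _         = z≤n
r≤toℕ-punchIn⇒r≤toℕ (x ∷ xs) {suc r} (suc k) v (suc i) (s≤s r≤k) (s≤s r≤) =
  s≤s (r≤toℕ-punchIn⇒r≤toℕ xs k v i r≤k r≤)

punchIn-mono-< : ∀ (xs : List A) k v i j →
                 toℕ i < toℕ j → toℕ (punchIn xs k v i) < toℕ (punchIn xs k v j)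
punchIn-mono-< xs       zero    v i       j       i<j       = s<s i<j
punchIn-mono-< (x ∷ xs) (suc k) v zero    (suc j) _         = z<s
punchIn-mono-< (x ∷ xs) (suc k) v (suc i) (suc j) (s<s i<j) = s<s (punchIn-mono-< xs k v i j i<j)

punchIn-cancel-< : ∀ (xs : List A) k v i j →
                   toℕ (punchIn xs k v i) < toℕ (punchIn xs k v j) → toℕ i < toℕ j
punchIn-cancel-< xs       zero    v i       j       ι<ι       = s<s⁻¹ ι<ι
punchIn-cancel-< (x ∷ xs) (suc k) v zero    (suc j) _         = z<s
punchIn-cancel-< (x ∷ xs) (suc k) v (suc i) (suc j) (s<s ι<ι) = s<s (punchIn-cancel-< xs k v i j ι<ι)

module _ (xs : List A) {r k : ℕ} (v : A) (r≤k : r ≤ k) (i : Fin (length xs)) where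

  punchIn-left⇔ : toℕ (punchIn xs k v i) < r ⇔ toℕ i < r
  punchIn-left⇔ = mk⇔ (≤-<-trans (toℕ≤toℕ-punchIn xs k v i))
    (λ i<r → subst (_< r) (sym (toℕ-punchIn-< xs k v i (<-≤-trans i<r r≤k))) i<r)

  punchIn-right⇔ : r ≤ toℕ (punchIn xs k v i) ⇔ r ≤ toℕ i
  punchIn-right⇔ = mk⇔ (r≤toℕ-punchIn⇒r≤toℕ xs k v i r≤k)
    (λ r≤i → ≤-trans r≤i (toℕ≤toℕ-punchIn xs k v i))

punchIn-<⇔ : ∀ (xs : List A) k v i j → toℕ (punchIn xs k v i) < toℕ (punchIn xs k v j) ⇔ toℕ i < toℕ j
punchIn-<⇔ xs k v i j = mk⇔ (punchIn-cancel-< xs k v i j) (punchIn-mono-< xs k v i j)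

<-cong⇔ : ∀ {a b c d} → a ≡ c → b ≡ d → (a < b) ⇔ (c < d)
<-cong⇔ refl refl = ⇔.refl

Occurrence3|12 Occurrence23|1 : ℕ → (w : List ℕ) → (i₁ i₂ i₃ : Fin (length w)) → Set
Occurrence3|12 r w i₁ i₂ i₃ =
  toℕ i₁ < r × r ≤ toℕ i₂ × toℕ i₂ < toℕ i₃ × lookup w i₂ < lookup w i₃ × lookup w i₃ < lookup w i₁
Occurrence23|1 r w i₁ i₂ i₃ =
  toℕ i₁ < toℕ i₂ × toℕ i₂ < r × r ≤ toℕ i₃ × lookup w i₃ < lookup w i₁ × lookup w i₁ < lookup w i₂

module _ (w : List ℕ) {r k : ℕ} (x : ℕ) (r≤k : r ≤ k) (i₁ i₂ i₃ : Fin (length w)) where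

  private
    ι = punchIn w k x
    value⇔ : ∀ i j →
             (lookup (insertAtℕ w k x) (ι i) < lookup (insertAtℕ w k x) (ι j)) ⇔ (lookup w i < lookup w j)
    value⇔ i j = <-cong⇔ (lookup-punchIn w k x i) (lookup-punchIn w k x j)

  occurrence3|12-punchIn :
    Occurrence3|12 r (insertAtℕ w k x) (ι i₁) (ι i₂) (ι i₃) ⇔ Occurrence3|12 r w i₁ i₂ i₃
  occurrence3|12-punchIn =
    punchIn-left⇔ w x r≤k i₁ ×-⇔ punchIn-right⇔ w x r≤k i₂ ×-⇔ punchIn-<⇔ w k x i₂ i₃ ×-⇔
    value⇔ i₂ i₃ ×-⇔ value⇔ i₃ i₁

  occurrence23|1-punchIn :
    Occurrence23|1 r (insertAtℕ w k x) (ι i₁) (ι i₂) (ι i₃) ⇔ Occurrence23|1 r w i₁ i₂ i₃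
  occurrence23|1-punchIn =
    punchIn-<⇔ w k x i₁ i₂ ×-⇔ punchIn-left⇔ w x r≤k i₂ ×-⇔ punchIn-right⇔ w x r≤k i₃ ×-⇔
    value⇔ i₃ i₁ ×-⇔ value⇔ i₁ i₂

module _ {w : List ℕ} {r k x : ℕ} (r≤k : r ≤ k) (k≤∣w∣ : k ≤ length w) (w<x : All (_< x) w) where

  private
    v = insertAtℕ w k x
    ι = punchIn w k x

    below-x⇒punchIn : ∀ j → lookup v j < x → ∃[ i ] ι i ≡ j
    below-x⇒punchIn j vⱼ<x =
      punchIn-surjective w k x k≤∣w∣ j (λ j≡k → <-irrefl (lookup-insertAtℕ w k x j j≡k) vⱼ<x)

    left-below-x : ∀ j → toℕ j < r → lookup v j < x
    left-below-x j j<r with i , refl ← punchIn-surjective w k x k≤∣w∣ j (<⇒≢ (<-≤-trans j<r r≤k)) =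
      subst (_< x) (sym (lookup-punchIn w k x i)) (All.lookup w<x (∈-lookup i))

  -- The largest entry of an occurrence lies left of r ≤ k, hence below x, so the occurrence
  -- misses the inserted x and pulls back along punchIn.
  Contains3|12-insertAtℕ⇔ : Contains3|12 r (insertAtℕ w k x) ⇔ Contains3|12 r w
  Contains3|12-insertAtℕ⇔ = mk⇔ pull push
    where
    push : Contains3|12 r w → Contains3|12 r v
    push (i₁ , i₂ , i₃ , occ) = ι i₁ , ι i₂ , ι i₃ , from (occurrence3|12-punchIn w x r≤k i₁ i₂ i₃) occ

    pullback : ∀ {j₁ j₂ j₃} → Occurrence3|12 r v j₁ j₂ j₃ →
               ∃[ i₁ ] ι i₁ ≡ j₁ → ∃[ i₂ ] ι i₂ ≡ j₂ → ∃[ i₃ ] ι i₃ ≡ j₃ → Contains3|12 r w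
    pullback occ (i₁ , refl) (i₂ , refl) (i₃ , refl) =
      i₁ , i₂ , i₃ , to (occurrence3|12-punchIn w x r≤k i₁ i₂ i₃) occ

    pull : Contains3|12 r v → Contains3|12 r w
    pull (j₁ , j₂ , j₃ , occ@(j₁<r , _ , _ , v₂<v₃ , v₃<v₁)) =
      pullback occ (below-x⇒punchIn j₁ v₁<x) (below-x⇒punchIn j₂ v₂<x) (below-x⇒punchIn j₃ v₃<x)
      where
      v₁<x = left-below-x j₁ j₁<r
      v₃<x = <-trans v₃<v₁ v₁<x
      v₂<x = <-trans v₂<v₃ v₃<x

  Contains23|1-insertAtℕ⇔ : Contains23|1 r (insertAtℕ w k x) ⇔ Contains23|1 r w
  Contains23|1-insertAtℕ⇔ = mk⇔ pull push
    where
    push : Contains23|1 r w → Contains23|1 r v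
    push (i₁ , i₂ , i₃ , occ) = ι i₁ , ι i₂ , ι i₃ , from (occurrence23|1-punchIn w x r≤k i₁ i₂ i₃) occ

    pullback : ∀ {j₁ j₂ j₃} → Occurrence23|1 r v j₁ j₂ j₃ →
               ∃[ i₁ ] ι i₁ ≡ j₁ → ∃[ i₂ ] ι i₂ ≡ j₂ → ∃[ i₃ ] ι i₃ ≡ j₃ → Contains23|1 r w
    pullback occ (i₁ , refl) (i₂ , refl) (i₃ , refl) =
      i₁ , i₂ , i₃ , to (occurrence23|1-punchIn w x r≤k i₁ i₂ i₃) occ

    pull : Contains23|1 r v → Contains23|1 r w
    pull (j₁ , j₂ , j₃ , occ@(_ , j₂<r , _ , v₃<v₁ , v₁<v₂)) =
      pullback occ (below-x⇒punchIn j₁ v₁<x) (below-x⇒punchIn j₂ v₂<x) (below-x⇒punchIn j₃ v₃<x)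
      where
      v₂<x = left-below-x j₂ j₂<r
      v₁<x = <-trans v₁<v₂ v₂<x
      v₃<x = <-trans v₃<v₁ v₁<x

upTo-suc-↭ : ∀ m → map suc (upTo (suc m)) ↭ suc m ∷ map suc (upTo m)
upTo-suc-↭ m = begin
  map suc (upTo (suc m))     ≡⟨ cong (map suc) (upTo-∷ʳ m) ⟨
  map suc (upTo m ∷ʳ m)      ≡⟨ map-++ suc (upTo m) [ m ] ⟩
  map suc (upTo m) ∷ʳ suc m  ↭⟨ ∷↭∷ʳ (suc m) (map suc (upTo m)) ⟨
  suc m ∷ map suc (upTo m)   ∎
  where open PermutationReasoning

IsPerm-∷⇔ : ∀ m w → IsPerm (suc m) (suc m ∷ w) ⇔ IsPerm m w
IsPerm-∷⇔ m w = mk⇔ (λ p → drop-∷ (↭-trans p (upTo-suc-↭ m)))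
                    (λ p → ↭-trans (prep (suc m) p) (↭-sym (upTo-suc-↭ m)))

IsPerm-insertAtℕ⇔ : ∀ m w k → IsPerm (suc m) (insertAtℕ w k (suc m)) ⇔ IsPerm m w
IsPerm-insertAtℕ⇔ m w k = ⇔.trans (mk⇔ (↭-trans (↭-sym ins↭)) (↭-trans ins↭)) (IsPerm-∷⇔ m w)
  where ins↭ = insertAtℕ-↭ w k (suc m)

IsPerm⇒length : ∀ m w → IsPerm m w → length w ≡ m
IsPerm⇒length m w p = trans (↭-length p) (trans (length-map suc (upTo m)) (length-upTo m))

IsPerm⇒All< : ∀ m w → IsPerm m w → All (_< suc m) w
IsPerm⇒All< m w p = All.tabulate (entry< ∘ ∈-map⁻ suc ∘ ∈-resp-↭ p)
  where
  entry< : ∀ {x} → ∃[ y ] (y ∈ upTo m × x ≡ suc y) → x < suc m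
  entry< (y , y∈ , refl) = s<s (∈-upTo⁻ y∈)

module _ (x : ℕ) where

  private
    ≢x? : Decidable (_≢ x)
    ≢x? y = ¬? (y ≟ x)

  φ-insertAtℕ : ∀ w k → All (_≢ x) w → φ x (insertAtℕ w k x) ≡ w
  φ-insertAtℕ w       zero    w≢x         =
    trans (filter-reject ≢x? (λ x≢x → x≢x refl)) (filter-all ≢x? w≢x)
  φ-insertAtℕ []      (suc k) []          = filter-reject ≢x? (λ x≢x → x≢x refl)
  φ-insertAtℕ (y ∷ w) (suc k) (y≢x ∷ w≢x) =
    trans (filter-accept ≢x? y≢x) (cong (y ∷_) (φ-insertAtℕ w k w≢x))

φ-insertAtℕ-IsPerm : ∀ m w k → IsPerm m w → φ (suc m) (insertAtℕ w k (suc m)) ≡ w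
φ-insertAtℕ-IsPerm m w k w-perm = φ-insertAtℕ (suc m) w k (All.map <⇒≢ (IsPerm⇒All< m w w-perm))

InKR-insertAtℕ⇔ : ∀ {r m k} w → r ≤ k → k ≤ length w → InKR r (suc m) (insertAtℕ w k (suc m)) ⇔ InK r m w
InKR-insertAtℕ⇔ {r} {m} {k} w r≤k k≤∣w∣ = mk⇔ InKR⇒InK InK⇒InKR
  where
  v = insertAtℕ w k (suc m)

  InKR⇒InK : InKR r (suc m) v → InK r m w
  InKR⇒InK ((v-perm , v∌3|12 , v∌23|1) , _) =
    w-perm ,
    v∌3|12 ∘ from (Contains3|12-insertAtℕ⇔ r≤k k≤∣w∣ w<1+m) ,
    v∌23|1 ∘ from (Contains23|1-insertAtℕ⇔ r≤k k≤∣w∣ w<1+m)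
    where
    w-perm = to (IsPerm-insertAtℕ⇔ m w k) v-perm
    w<1+m = IsPerm⇒All< m w w-perm

  InK⇒InKR : InK r m w → InKR r (suc m) v
  InK⇒InKR (w-perm , w∌3|12 , w∌23|1) =
    (from (IsPerm-insertAtℕ⇔ m w k) w-perm ,
     w∌3|12 ∘ to (Contains3|12-insertAtℕ⇔ r≤k k≤∣w∣ w<1+m) ,
     w∌23|1 ∘ to (Contains23|1-insertAtℕ⇔ r≤k k≤∣w∣ w<1+m)) ,
    fromℕ< k<∣v∣ , subst (r ≤_) (sym (toℕ-fromℕ< k<∣v∣)) r≤k ,
    lookup-insertAtℕ w k (suc m) (fromℕ< k<∣v∣) (toℕ-fromℕ< k<∣v∣)
    where
    w<1+m = IsPerm⇒All< m w w-perm
    k<∣v∣ : k < length v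
    k<∣v∣ = subst (k <_) (sym (length-insertAtℕ w k (suc m))) (s≤s k≤∣w∣)

InKR⇒insertAtℕ : ∀ {r m} v → InKR r (suc m) v →
                 ∃[ w ] ∃[ k ] (InK r m w × r ≤ k × k ≤ m × v ≡ insertAtℕ w k (suc m))
InKR⇒insertAtℕ {r} {m} v v∈KR@(_ , j , r≤j , vⱼ≡1+m) = w , toℕ j , w∈K , r≤j , j≤m , v≡
  where
  w = removeAt v j
  j≤∣w∣ = toℕ≤length-removeAt v j
  v≡ : v ≡ insertAtℕ w (toℕ j) (suc m)
  v≡ = trans (insertAtℕ-removeAt v j) (cong (insertAtℕ w (toℕ j)) vⱼ≡1+m)
  w∈K = to (InKR-insertAtℕ⇔ w r≤j j≤∣w∣) (subst (InKR r (suc m)) v≡ v∈KR)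
  j≤m = subst (toℕ j ≤_) (IsPerm⇒length m w (proj₁ w∈K)) j≤∣w∣

φ-InKR : ∀ {r m} v → InKR r (suc m) v → InK r m (φ (suc m) v)
φ-InKR {r} {m} v v∈KR with w , k , w∈K , _ , _ , refl ← InKR⇒insertAtℕ v v∈KR =
  subst (InK r m) (sym (φ-insertAtℕ-IsPerm m w k (proj₁ w∈K))) w∈K

fiber⇔ : ∀ {r m} w → InK r m w → ∀ v →
         (InKR r (suc m) v × φ (suc m) v ≡ w) ⇔ InsertedBetween w (suc m) r (suc m) v
fiber⇔ {r} {m} w w∈K@(w-perm , _) v = mk⇔ position insertion
  where
  insertion : InsertedBetween w (suc m) r (suc m) v → InKR r (suc m) v × φ (suc m) v ≡ w
  insertion (k , r≤k , s≤s k≤m , refl) =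
    from (InKR-insertAtℕ⇔ w r≤k (subst (k ≤_) (sym (IsPerm⇒length m w w-perm)) k≤m)) w∈K ,
    φ-insertAtℕ-IsPerm m w k w-perm

  position : InKR r (suc m) v × φ (suc m) v ≡ w → InsertedBetween w (suc m) r (suc m) v
  position (v∈KR , φv≡w) with u , k , u∈K , r≤k , k≤m , refl ← InKR⇒insertAtℕ v v∈KR =
    k , r≤k , s≤s k≤m , cong (λ u → insertAtℕ u k (suc m)) u≡w
    where
    u≡w = trans (sym (φ-insertAtℕ-IsPerm m u k (proj₁ u∈K))) φv≡w

proposition2p1 : (n r : ℕ) → 1 ≤ n → r ≤ n ∸ 1 →
    ((v : List ℕ) → InKR r n v → InK r (n ∸ 1) (φ n v))
    × ((w : List ℕ) → InK r (n ∸ 1) w → ∃[ v ] (InKR r n v × φ n v ≡ w))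
    × ((w : List ℕ) → InK r (n ∸ 1) w →
        ∃[ L ] (Unique L × length L ≡ n ∸ r ×
          ((v : List ℕ) → (v ∈ L) ⇔ (InKR r n v × φ n v ≡ w))))
proposition2p1 (suc m) r (s≤s z≤n) r≤m = φ-InKR , lift , fiber
  where
  lift : (w : List ℕ) → InK r m w → ∃[ v ] (InKR r (suc m) v × φ (suc m) v ≡ w)
  lift w w∈K = insertAtℕ w r (suc m) , from (fiber⇔ w w∈K _) (r , ≤-refl , s≤s r≤m , refl)

  fiber : (w : List ℕ) → InK r m w →
          ∃[ L ] (Unique L × length L ≡ suc m ∸ r ×
                  ((v : List ℕ) → (v ∈ L) ⇔ (InKR r (suc m) v × φ (suc m) v ≡ w)))
  fiber w w∈K@(w-perm , _) =
    insertions w (suc m) r (suc m) ,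
    insertions-unique w (suc m) (All.map <⇒≢ (IsPerm⇒All< m w w-perm)) r≤1+m
                      (s≤s (≤-reflexive (sym (IsPerm⇒length m w w-perm)))) ,
    length-applyUpTo _ (suc m ∸ r) ,
    λ v → ⇔.trans (∈-insertions⇔ w (suc m) r≤1+m v) (⇔.sym (fiber⇔ w w∈K v))
    where r≤1+m = m≤n⇒m≤1+n r≤m
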